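{- Let $n\geq 2$. The partition lattice $\Pi_n$ is weakly coset-like if and only if $n\leq 4$.
   Context: $\Pi_n$ is the lattice of all set partitions of $\{1,\ldots,n\}$ ordered by refinement. For a finite lattice $L$ with distinct bottom $\widehat 0$ and top $\widehat 1$, let $J$ be its set of join-irreducible elements, $J_x=\{j\in J:j\leq x\}$, and $\mu$ the Möbius function of $L$ ($\mu(x,x)=1$, $\mu(y,x)=-\sum_{y<z\leq x}\mu(z,x)$ for $y<x$). The probabilistic zeta function is $P(L,s)=\sum_{x\in L\setminus\{\widehat 0\}}\mu(x,\widehat 1)\,(|J|/|J_x|)^{ -s}$. $L$ is weakly coset-like if $P(L,s)$ is a finite ordinary Dirichlet series $\sum_{m} a_m m^{ -s}$ (i.e. after collecting terms with equal base $|J|/|J_x|$, every base with nonzero total coefficient is an integer). -}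

module Defs where

open import Data.Bool using (Bool; true; false; not; _∧_; _∨_; if_then_else_)
open import Data.Nat using (ℕ; zero; suc; _*_; _⊔_; _≡ᵇ_)
open import Data.Nat.Divisibility using (_∣_)
open import Data.Integer using (ℤ; 0ℤ; 1ℤ; -_) renaming (_+_ to _+ℤ_)
open import Data.List using (List; []; _∷_; map; concatMap; upTo; length; filterᵇ; allFin; foldr)
open import Data.List.Membership.Propositional using (_∈_)
open import Data.Vec using (Vec; []; _∷_; lookup; tabulate; replicate)
open import Data.Vec.Properties using (≡-dec)
open import Data.Fin using (Fin; toℕ)
import Data.Nat as ℕ
open import Relation.Nullary using (does; ¬_)
open import Relation.Binary.PropositionalEquality using (_≡_)

allᵇ : {A : Set} → (A → Bool) → List A → Bool
allᵇ p []       = true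
allᵇ p (x ∷ xs) = p x ∧ allᵇ p xs

sumℤ : List ℤ → ℤ
sumℤ = foldr _+ℤ_ 0ℤ

-- Generic notions for a finite lattice L, presented by
--   * a carrier A with decidable (Boolean) equality _==_,
--   * a Boolean order relation _≤ᵇ_,
--   * the complete, duplicate-free list `elems` of the elements of L,
--   * the bottom element `bot` and the top element `top`.

module FiniteLattice {A : Set} (_==_ : A → A → Bool) (_≤ᵇ_ : A → A → Bool)
                     (elems : List A) (bot top : A) where

  isJoinOf : A → A → A → Bool
  isJoinOf a b j = (a ≤ᵇ j) ∧ (b ≤ᵇ j)
                   ∧ allᵇ (λ c → not ((a ≤ᵇ c) ∧ (b ≤ᵇ c)) ∨ (j ≤ᵇ c)) elems

  isJoinIrr : A → Bool
  isJoinIrr j = not (j == bot)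
                ∧ allᵇ (λ a → allᵇ (λ b → not (isJoinOf a b j) ∨ (j == a) ∨ (j == b)) elems) elems

  nJ : ℕ
  nJ = length (filterᵇ isJoinIrr elems)

  nJ≤ : A → ℕ
  nJ≤ x = length (filterᵇ (λ j → isJoinIrr j ∧ (j ≤ᵇ x)) elems)

  -- Möbius function, by the recursion
  --   μ(x,x) = 1,  μ(y,x) = - Σ_{y < z ≤ x} μ(z,x)  (y < x),  μ(y,x) = 0 otherwise,
  -- computed with a fuel parameter; fuel = |L| bounds the length of every chain,
  -- so `mobius` below is the Möbius function of L.
  mobiusF : ℕ → A → A → ℤ
  mobiusF zero    y x = 0ℤ
  mobiusF (suc k) y x =
    if y == x then 1ℤ
    else if y ≤ᵇ x
      then - sumℤ (map (λ z → mobiusF k z x)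
                       (filterᵇ (λ z → (y ≤ᵇ z) ∧ not (y == z) ∧ (z ≤ᵇ x)) elems))
      else 0ℤ

  mobius : A → A → ℤ
  mobius = mobiusF (length elems)

  -- P(L,s) = Σ_{x ≠ 0̂} μ(x,1̂) (|J|/|J_x|)^{-s}.
  -- Two terms x, y have the same base |J|/|J_x| = |J|/|J_y|
  -- (equality of rationals, by cross-multiplication).
  sameBase : A → A → Bool
  sameBase x y = (nJ * nJ≤ y) ≡ᵇ (nJ * nJ≤ x)

  -- total coefficient of the base |J|/|J_x| in P(L,s) after collecting terms
  collectedCoeff : A → ℤ
  collectedCoeff x =
    sumℤ (map (λ y → mobius y top)
              (filterᵇ (λ y → not (y == bot) ∧ sameBase x y) elems))

  -- weakly coset-like: every base with nonzero total coefficient is an integer,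
  -- i.e. |J_x| divides |J|
  WeaklyCosetLike : Set
  WeaklyCosetLike =
    ∀ x → x ∈ elems → ¬ (x ≡ bot) → ¬ (collectedCoeff x ≡ 0ℤ) → nJ≤ x ∣ nJ

-- A set partition of {1,…,n} (here Fin n) is encoded canonically by its
-- restricted growth string x : Vec ℕ n : x_i is the index of the block
-- containing i, blocks numbered 0,1,2,… in order of their least element.

Partition : ℕ → Set
Partition n = Vec ℕ n

-- all restricted growth strings of length k whose entries are chosen after
-- m blocks have already been opened
rgs : (k : ℕ) → ℕ → List (Vec ℕ k)
rgs zero    m = [] ∷ []
rgs (suc k) m = concatMap (λ a → map (a ∷_) (rgs k (m ⊔ suc a))) (upTo (suc m))

partitions : (n : ℕ) → List (Partition n)
partitions n = rgs n 0

_==Π_ : ∀ {n} → Partition n → Partition n → Bool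
x ==Π y = does (≡-dec ℕ._≟_ x y)

_≤Π_ : ∀ {n} → Partition n → Partition n → Bool
_≤Π_ {n} x y = allᵇ (λ i → allᵇ (λ j → not (lookup x i ≡ᵇ lookup x j) ∨ (lookup y i ≡ᵇ lookup y j))
                              (allFin n)) (allFin n)

botΠ : (n : ℕ) → Partition n
botΠ n = tabulate toℕ

topΠ : (n : ℕ) → Partition n
topΠ n = replicate n 0

module Π (n : ℕ) = FiniteLattice (_==Π_ {n}) (_≤Π_ {n}) (partitions n) (botΠ n) (topΠ n)

PartitionLatticeWeaklyCosetLike : ℕ → Set
PartitionLatticeWeaklyCosetLike n = Π.WeaklyCosetLike n

module Submission where

-- The join-irreducibles of Π n are its atoms,
-- the partitions with a single non-singleton block {p, q}; hence |J_x| is the number of pairs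
-- i < j in a common block of x, and |J| = C(n,2). For n = m + 1 ≥ 5 let c be the coatom with
-- blocks {0, …, m - 1} and {m}, so |J_c| = C(m,2). No partition other than 1̂ has more than
-- C(m,2) such pairs, so every y with |J_y| = C(m,2) is covered only by 1̂ and μ(y, 1̂) = -1:
-- the collected coefficient of the base C(n,2)/C(m,2) is negative. But C(m,2) divides
-- C(n,2) = C(m,2) + m only if C(m,2) ≤ m, which fails for m ≥ 4. For n ≤ 4 every |J_x|
-- divides |J|, which is checked by evaluation.

open import Defs
open import Data.Bool using (Bool; true; false; not; _∧_; _∨_; T)
open import Data.Bool.Properties using (T?; T-∧; T-∨)
open import Data.Empty using (⊥-elim)
open import Data.Fin using (Fin; zero; suc; toℕ)
import Data.Fin as Fin
import Data.Fin.Properties as Fin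
open import Data.Integer using (ℤ; 0ℤ; 1ℤ; -1ℤ)
import Data.Integer as ℤ
import Data.Integer.Properties as ℤ
open import Data.List using (List; []; _∷_; [_]; length; map; concatMap; filter; filterᵇ; _++_; allFin; upTo)
open import Data.List.Properties
  using (filter-notAll; filter-≐; ++-identityʳ; ++-assoc; length-++; length-map; length-tabulate)
open import Data.List.Membership.Propositional using (_∈_; _∉_; find; lose)
open import Data.List.Membership.Propositional.Properties
open import Data.List.Relation.Binary.Subset.Propositional using (_⊆_)
open import Data.List.Relation.Unary.All using (All; []; _∷_; all?)
import Data.List.Relation.Unary.All as All
open import Data.List.Relation.Unary.All.Properties using (¬Any⇒All¬)
open import Data.List.Relation.Unary.AllPairs using ([]; _∷_)
open import Data.List.Relation.Unary.Any using (Any; here; there)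
import Data.List.Relation.Unary.Any as Any
open import Data.List.Relation.Unary.Unique.Propositional using (Unique)
import Data.List.Relation.Unary.Unique.Propositional.Properties as Unique
open import Data.Nat
open import Data.Nat.Divisibility using (_∣_; _∣?_; ∣-refl; ∣m+n∣m⇒∣n; >⇒∤)
open import Data.Nat.Properties
open import Data.Product using (∃; _×_; _,_; proj₁; proj₂)
import Data.Product as Product
open import Data.Product.Properties using () renaming (≡-dec to ×-≡-dec)
open import Data.Sum using (_⊎_; inj₁; inj₂)
import Data.Sum as Sum
open import Data.Vec using (Vec; []; _∷_; _∷ʳ_; head; lookup; tabulate; replicate)
open import Data.Vec.Properties using (≡-dec; ∷-injectiveʳ; lookup∘tabulate; lookup-replicate; tabulate-cong)
open import Function using (id; _∘_; case_of_; _⇔_; mk⇔; Equivalence)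
open Equivalence using (to; from)
open import Relation.Binary.Definitions using (DecidableEquality; tri<; tri≈; tri>)
open import Relation.Binary.PropositionalEquality hiding ([_])
open import Relation.Nullary using (¬_; Dec; yes; no; ¬?)
open import Relation.Nullary.Decidable using (True; toWitness; _⊎-dec_)
open import Relation.Nullary.Negation using (contradiction)
open import Relation.Unary using (_≐_)

private
  variable
    A B : Set

allᵇ⁺ : (p : A → Bool) (xs : List A) → (∀ {x} → x ∈ xs → T (p x)) → T (allᵇ p xs)
allᵇ⁺ p []       h = _
allᵇ⁺ p (x ∷ xs) h = from T-∧ (h (here refl) , allᵇ⁺ p xs (h ∘ there))

allᵇ⁻ : (p : A → Bool) (xs : List A) → T (allᵇ p xs) → ∀ {x} → x ∈ xs → T (p x)
allᵇ⁻ p (y ∷ xs) h (here refl) = proj₁ (to T-∧ h)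
allᵇ⁻ p (y ∷ xs) h (there x∈) = allᵇ⁻ p xs (proj₂ (to (T-∧ {p y}) h)) x∈

T-not∨⇔ : ∀ {x y} → T (not x ∨ y) ⇔ (T x → T y)
T-not∨⇔ {false} = mk⇔ (λ _ ()) _
T-not∨⇔ {true}  = mk⇔ (λ y _ → y) (λ h → h _)

T-not⇔¬T : ∀ {x} → T (not x) ⇔ (¬ T x)
T-not⇔¬T {false} = mk⇔ (λ _ ()) _
T-not⇔¬T {true}  = mk⇔ (λ ()) (λ h → h _)

module _ (_≟_ : DecidableEquality A) where

  Unique-⊆⇒length≤ : {xs ys : List A} → Unique xs → xs ⊆ ys → length xs ≤ length ys
  Unique-⊆⇒length≤ {[]}             _              _   = z≤n
  Unique-⊆⇒length≤ {x ∷ xs} {ys} (x∉xs ∷ unique) xs⊆ys = begin-strict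
    length xs                         ≤⟨ Unique-⊆⇒length≤ unique xs⊆ys-x ⟩
    length (filter (¬? ∘ (x ≟_)) ys) <⟨ filter-notAll (¬? ∘ (x ≟_)) ys x∈ys ⟩
    length ys                         ∎
    where
    open ≤-Reasoning
    xs⊆ys-x : xs ⊆ filter (¬? ∘ (x ≟_)) ys
    xs⊆ys-x y∈xs = ∈-filter⁺ (¬? ∘ (x ≟_)) (xs⊆ys (there y∈xs)) (All.lookup x∉xs y∈xs)
    x∈ys : Any (λ y → ¬ ¬ x ≡ y) ys
    x∈ys = Any.map (λ x≡y ¬x≡y → ¬x≡y x≡y) (xs⊆ys (here refl))

  Unique-⊂⇒length< : {xs ys : List A} {w : A} → Unique xs → xs ⊆ ys → w ∈ ys → w ∉ xs →
                     length xs < length ys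
  Unique-⊂⇒length< {xs} unique xs⊆ys w∈ys w∉xs =
    Unique-⊆⇒length≤ (¬Any⇒All¬ xs w∉xs ∷ unique) λ where
      (here refl)  → w∈ys
      (there v∈xs) → xs⊆ys v∈xs

  Unique-⊆-⊇⇒length≡ : {xs ys : List A} → Unique xs → Unique ys → xs ⊆ ys → ys ⊆ xs →
                       length xs ≡ length ys
  Unique-⊆-⊇⇒length≡ uxs uys xs⊆ys ys⊆xs =
    ≤-antisym (Unique-⊆⇒length≤ uxs xs⊆ys) (Unique-⊆⇒length≤ uys ys⊆xs)

  Unique-⊆-length≥⇒⊇ : {xs ys : List A} → Unique xs → xs ⊆ ys → length ys ≤ length xs → ys ⊆ xs
  Unique-⊆-length≥⇒⊇ {xs} unique xs⊆ys ys≤xs {w} w∈ys with Any.any? (w ≟_) xs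
  ... | yes w∈xs = w∈xs
  ... | no  w∉xs = ⊥-elim (<⇒≱ (Unique-⊂⇒length< unique xs⊆ys w∈ys w∉xs) ys≤xs)

map-unique : (f : A → B) {xs : List A} → Unique xs →
             (∀ {x y} → x ∈ xs → y ∈ xs → f x ≡ f y → x ≡ y) → Unique (map f xs)
map-unique f {[]}     _                _         = []
map-unique f {x ∷ xs} (x∉xs ∷ unique) injective =
  All.tabulate (λ fy∈ fx≡fy → case ∈-map⁻ f fy∈ of λ where
    (y , y∈xs , refl) → All.lookup x∉xs y∈xs (injective (here refl) (there y∈xs) fx≡fy))
  ∷ map-unique f unique (λ x∈ y∈ → injective (there x∈) (there y∈))

length≥2 : {x y : A} {xs : List A} → x ∈ xs → y ∈ xs → x ≢ y → 2 ≤ length xs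
length≥2 {xs = _ ∷ _ ∷ _} _           _           _   = s≤s (s≤s z≤n)
length≥2 {xs = _ ∷ []}    (here refl) (here refl) x≢y = ⊥-elim (x≢y refl)

∃-∈ : {xs : List A} → 0 < length xs → ∃ λ x → x ∈ xs
∃-∈ {xs = x ∷ _} _ = x , here refl

concatMap-unique : (f : A → List B) {xs : List A} → Unique xs → (∀ {x} → x ∈ xs → Unique (f x)) →
                   (∀ {x x′ z} → z ∈ f x → z ∈ f x′ → x ≡ x′) → Unique (concatMap f xs)
concatMap-unique f {[]}     _                _  _ = []
concatMap-unique f {x ∷ xs} (x∉xs ∷ unique) uf disjoint =
  Unique.++⁺ (uf (here refl)) (concatMap-unique f unique (uf ∘ there) disjoint) apart
  where
  apart : ∀ {z} → ¬ (z ∈ f x × z ∈ concatMap f xs)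
  apart (z∈fx , z∈rest) with x′ , x′∈xs , z∈fx′ ← find (∈-concatMap⁻ f {xs = xs} z∈rest) =
    All.lookup x∉xs x′∈xs (disjoint z∈fx z∈fx′)

-- Möbius function and collected coefficients in a finite lattice

sumℤ-ones : (f : A → ℤ) (xs : List A) → (∀ {x} → x ∈ xs → f x ≡ 1ℤ) →
            sumℤ (map f xs) ≡ ℤ.+ length xs
sumℤ-ones f []       _    = refl
sumℤ-ones f (x ∷ xs) ones rewrite ones (here refl) | sumℤ-ones f xs (ones ∘ there) = refl

sumℤ-nonpositive : (f : A → ℤ) (xs : List A) → (∀ {x} → x ∈ xs → f x ℤ.≤ 0ℤ) →
                   sumℤ (map f xs) ℤ.≤ 0ℤ
sumℤ-nonpositive f []       _        = ℤ.≤-refl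
sumℤ-nonpositive f (x ∷ xs) nonpos = ℤ.+-mono-≤ (nonpos (here refl)) (sumℤ-nonpositive f xs (nonpos ∘ there))

sumℤ-negative : (f : A → ℤ) {xs : List A} {c : A} → c ∈ xs → (∀ {x} → x ∈ xs → f x ℤ.≤ -1ℤ) →
                sumℤ (map f xs) ℤ.≤ -1ℤ
sumℤ-negative f {x ∷ xs} (here refl) neg =
  ℤ.+-mono-≤ (neg (here refl)) (sumℤ-nonpositive f xs λ x∈ → ℤ.≤-trans (neg (there x∈)) (ℤ.-≤+ {0} {0}))
sumℤ-negative f {x ∷ xs} (there c∈)  neg =
  ℤ.+-mono-≤ (ℤ.≤-trans (neg (here refl)) (ℤ.-≤+ {0} {0})) (sumℤ-negative f c∈ (neg ∘ there))

module FiniteLatticeProperties {A : Set} (_==_ : A → A → Bool) (_≤ᵇ_ : A → A → Bool)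
                               (elems : List A) (bot top : A) where
  open FiniteLattice _==_ _≤ᵇ_ elems bot top

  weaklyCosetLike-by-divisibility : All (λ x → x ≡ bot ⊎ nJ≤ x ∣ nJ) elems → WeaklyCosetLike
  weaklyCosetLike-by-divisibility checks x x∈ x≢bot _ with All.lookup checks x∈
  ... | inj₁ x≡bot   = ⊥-elim (x≢bot x≡bot)
  ... | inj₂ x∣nJ   = x∣nJ

  strictlyAbove : A → List A
  strictlyAbove y = filterᵇ (λ z → (y ≤ᵇ z) ∧ not (y == z) ∧ (z ≤ᵇ top)) elems

  mobiusF-top : ∀ k → T (top == top) → mobiusF (suc k) top top ≡ 1ℤ
  mobiusF-top k top==top with top == top | top==top
  ... | true | _ = refl

  mobiusF-coatom : ∀ {fuel} → 2 ≤ fuel → ∀ {y} → T (top == top) → ¬ T (y == top) → T (y ≤ᵇ top) →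
                   top ∈ strictlyAbove y → (∀ {z} → z ∈ strictlyAbove y → z ≡ top) →
                   mobiusF fuel y top ℤ.≤ -1ℤ
  mobiusF-coatom {suc (suc k)} (s≤s (s≤s _)) {y} top==top y≠top y≤top top∈ only-top
    with y == top | y≠top | y ≤ᵇ top | y≤top
  ... | true  | y≠top′ | _    | _ = ⊥-elim (y≠top′ _)
  ... | false | _      | true | _ =
    subst (λ s → ℤ.- s ℤ.≤ -1ℤ) (sym (sumℤ-ones _ _ λ z∈ → subst (λ z → mobiusF (suc k) z top ≡ 1ℤ)
                                                                  (sym (only-top z∈)) (mobiusF-top k top==top)))
          (negated (∈-length top∈))
    where
    negated : ∀ {m} → 0 < m → ℤ.- (ℤ.+ m) ℤ.≤ -1ℤ
    negated (s≤s _) = ℤ.-≤- z≤n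

  collectedCoeff≢0 : ∀ {x} → x ∈ elems → ¬ T (x == bot) →
                     (∀ {y} → y ∈ elems → nJ * nJ≤ y ≡ nJ * nJ≤ x → mobius y top ℤ.≤ -1ℤ) →
                     collectedCoeff x ≢ 0ℤ
  collectedCoeff≢0 {x} x∈ x≠bot negative coeff≡0 =
    case subst (ℤ._≤ -1ℤ) coeff≡0 (sumℤ-negative (λ y → mobius y top) x∈class inClass) of λ ()
    where
    x∈class : x ∈ filterᵇ (λ y → not (y == bot) ∧ sameBase x y) elems
    x∈class = ∈-filter⁺ (T? ∘ _) x∈
      (from (T-∧ {not (x == bot)}) (from T-not⇔¬T x≠bot , ≡⇒≡ᵇ (nJ * nJ≤ x) _ refl))
    inClass : ∀ {y} → y ∈ filterᵇ (λ y → not (y == bot) ∧ sameBase x y) elems → mobius y top ℤ.≤ -1ℤ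
    inClass {y} y∈ with y∈elems , fits ← ∈-filter⁻ (T? ∘ λ y → not (y == bot) ∧ sameBase x y) y∈ =
      negative y∈elems (≡ᵇ⇒≡ _ _ (proj₂ (to (T-∧ {not (y == bot)}) fits)))

-- Refinement of labellings

record _⊑_ {k} (x y : Vec ℕ k) : Set where
  constructor refines
  field sameBlock : ∀ i j → lookup x i ≡ lookup x j → lookup y i ≡ lookup y j
open _⊑_ public

⊑-refl : ∀ {k} {x : Vec ℕ k} → x ⊑ x
⊑-refl = refines λ _ _ → id

T-≡ᵇ-implication : ∀ a b c d → T (not (a ≡ᵇ b) ∨ (c ≡ᵇ d)) ⇔ (a ≡ b → c ≡ d)
T-≡ᵇ-implication a b c d = mk⇔
  (λ h → ≡ᵇ⇒≡ c d ∘ to (T-not∨⇔ {a ≡ᵇ b}) h ∘ ≡⇒≡ᵇ a b)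
  (λ h → from (T-not∨⇔ {a ≡ᵇ b}) (≡⇒≡ᵇ c d ∘ h ∘ ≡ᵇ⇒≡ a b))

≤Π⇔⊑ : ∀ {n} (x y : Partition n) → T (x ≤Π y) ⇔ x ⊑ y
≤Π⇔⊑ {n} x y = mk⇔
  (λ h → refines λ i j → to (T-≡ᵇ-implication _ _ _ _)
                (allᵇ⁻ _ _ (allᵇ⁻ _ _ h (∈-allFin i)) (∈-allFin j)))
  (λ x⊑y → allᵇ⁺ _ (allFin n) λ {i} _ → allᵇ⁺ _ (allFin n) λ {j} _ →
                from (T-≡ᵇ-implication _ _ _ _) (sameBlock x⊑y i j))

==Π⇔≡ : ∀ {n} (x y : Partition n) → T (x ==Π y) ⇔ x ≡ y
==Π⇔≡ x y with ≡-dec _≟_ x y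
... | yes x≡y = mk⇔ (λ _ → x≡y) _
... | no  x≢y = mk⇔ (λ ()) x≢y

-- Restricted growth strings: `RGS m v` says that v is the tail of a restricted
-- growth string whose prefix has already opened the blocks 0, …, m - 1.

data RGS : ℕ → ∀ {k} → Vec ℕ k → Set where
  []  : ∀ {m} → RGS m []
  _∷_ : ∀ {m a k} {v : Vec ℕ k} → a ≤ m → RGS (m ⊔ suc a) v → RGS m (a ∷ v)

∈-rgs⁻ : ∀ k m {v} → v ∈ rgs k m → RGS m v
∈-rgs⁻ zero    m {[]} _ = []
∈-rgs⁻ (suc k) m v∈
  with a , a∈ , v∈a ← find (∈-concatMap⁻ (λ a → map (a ∷_) (rgs k (m ⊔ suc a))) {xs = upTo (suc m)} v∈)
  with w , w∈ , refl ← ∈-map⁻ (a ∷_) v∈a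
  = ≤-pred (∈-upTo⁻ a∈) ∷ ∈-rgs⁻ k (m ⊔ suc a) w∈

∈-rgs⁺ : ∀ k m {v : Vec ℕ k} → RGS m v → v ∈ rgs k m
∈-rgs⁺ zero    m []                  = here refl
∈-rgs⁺ (suc k) m {a ∷ v} (a≤m ∷ rv) =
  ∈-concatMap⁺ (λ a → map (a ∷_) (rgs k (m ⊔ suc a))) {xs = upTo (suc m)}
    (lose (∈-upTo⁺ (s≤s a≤m)) (∈-map⁺ (a ∷_) (∈-rgs⁺ k (m ⊔ suc a) rv)))

rgs-unique : ∀ k m → Unique (rgs k m)
rgs-unique zero    m = [] ∷ []
rgs-unique (suc k) m =
  concatMap-unique _ (Unique.upTo⁺ (suc m))
    (λ {a} _ → Unique.map⁺ ∷-injectiveʳ (rgs-unique k (m ⊔ suc a)))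
    same-head
  where
  same-head : ∀ {a a′ z} → z ∈ map (a ∷_) (rgs k (m ⊔ suc a)) →
              z ∈ map (a′ ∷_) (rgs k (m ⊔ suc a′)) → a ≡ a′
  same-head z∈ z∈′ with _ , _ , refl ← ∈-map⁻ _ z∈ | _ , _ , refl ← ∈-map⁻ _ z∈′ = refl

∈-partitions⇔ : ∀ {n} {x : Partition n} → x ∈ partitions n ⇔ RGS 0 x
∈-partitions⇔ {n} = mk⇔ (∈-rgs⁻ n 0) (∈-rgs⁺ n 0)

partitions-unique : ∀ n → Unique (partitions n)
partitions-unique n = rgs-unique n 0

-- The labels below m name blocks opened by the common prefix, so two
-- restricted growth strings with the same blocks must agree on them.

LabelsAgree : ∀ {k} → ℕ → Vec ℕ k → Vec ℕ k → Set
LabelsAgree m x y = ∀ i → lookup x i < m → lookup y i ≡ lookup x i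

heads-agree : ∀ {m a b} → a ≤ m → b ≤ m → (a < m → b ≡ a) → (b < m → a ≡ b) → a ≡ b
heads-agree a≤m b≤m agreeᵃ agreeᵇ with m≤n⇒m<n∨m≡n a≤m | m≤n⇒m<n∨m≡n b≤m
... | inj₁ a<m | _         = sym (agreeᵃ a<m)
... | inj₂ _   | inj₁ b<m  = agreeᵇ b<m
... | inj₂ a≡m | inj₂ b≡m  = trans a≡m (sym b≡m)

new-label : ∀ {m a a′} → a ≤ m → a′ < m ⊔ suc a → a′ < m ⊎ a′ ≡ a
new-label {m} {a} {a′} a≤m a′< with a′ <? m
... | yes a′<m = inj₁ a′<m
... | no  a′≮m with ≤-total m (suc a)
...   | inj₁ m≤1+a = inj₂ (≤-antisym (≤-pred (subst (a′ <_) (m≤n⇒m⊔n≡n m≤1+a) a′<))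
                                    (≤-trans a≤m (≮⇒≥ a′≮m)))
...   | inj₂ 1+a≤m = ⊥-elim (a′≮m (subst (a′ <_) (m≥n⇒m⊔n≡m 1+a≤m) a′<))

RGS-canonical : ∀ {m k} {x y : Vec ℕ k} → RGS m x → RGS m y → x ⊑ y → y ⊑ x →
                LabelsAgree m x y → LabelsAgree m y x → x ≡ y
RGS-canonical [] [] _ _ _ _ = refl
RGS-canonical {m} {x = a ∷ x} {b ∷ y} (a≤m ∷ rx) (b≤m ∷ ry) x⊑y y⊑x agreeˣ agreeʸ
  with refl ← heads-agree a≤m b≤m (agreeˣ zero) (agreeʸ zero)
  = cong (a ∷_) (RGS-canonical rx ry (tail⊑ x⊑y) (tail⊑ y⊑x)
                                     (extend x⊑y agreeˣ) (extend y⊑x agreeʸ))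
  where
  extend : ∀ {u w : Vec ℕ _} → (a ∷ u) ⊑ (a ∷ w) → LabelsAgree m (a ∷ u) (a ∷ w) →
           LabelsAgree (m ⊔ suc a) u w
  extend u⊑w agree i lt with new-label a≤m lt
  ... | inj₁ <m   = agree (suc i) <m
  ... | inj₂ is-a = trans (sameBlock u⊑w (suc i) zero is-a) (sym is-a)
  tail⊑ : ∀ {c d} {u w : Vec ℕ _} → (c ∷ u) ⊑ (d ∷ w) → u ⊑ w
  tail⊑ u⊑w = refines λ i j → sameBlock u⊑w (suc i) (suc j)

RGS-canonical₀ : ∀ {k} {x y : Vec ℕ k} → RGS 0 x → RGS 0 y → x ⊑ y → y ⊑ x → x ≡ y
RGS-canonical₀ rx ry x⊑y y⊑x = RGS-canonical rx ry x⊑y y⊑x (λ _ ()) (λ _ ())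

-- Normalisation of an arbitrary labelling to a restricted growth string:
-- σ lists the labels met so far, and a label is renamed to its position in σ.

indexOf : ℕ → List ℕ → ℕ
indexOf a []      = 0
indexOf a (b ∷ σ) with a ≟ b
... | yes _ = 0
... | no  _ = suc (indexOf a σ)

indexOf-head : ∀ a σ → indexOf a (a ∷ σ) ≡ 0
indexOf-head a σ with a ≟ a
... | yes _   = refl
... | no  a≢a = ⊥-elim (a≢a refl)

indexOf-++-∈ : ∀ {a} σ δ → a ∈ σ → indexOf a (σ ++ δ) ≡ indexOf a σ
indexOf-++-∈ {a} (b ∷ σ) δ a∈ with a ≟ b | a∈
... | yes _ | _          = refl
... | no  _ | there a∈σ = cong suc (indexOf-++-∈ σ δ a∈σ)
... | no a≢b | here a≡b = ⊥-elim (a≢b a≡b)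

indexOf-++-∉ : ∀ {a} σ δ → a ∉ σ → indexOf a (σ ++ δ) ≡ length σ + indexOf a δ
indexOf-++-∉     []      δ _   = refl
indexOf-++-∉ {a} (b ∷ σ) δ a∉ with a ≟ b
... | yes a≡b = ⊥-elim (a∉ (here a≡b))
... | no  _   = cong suc (indexOf-++-∉ σ δ (a∉ ∘ there))

indexOf-∉ : ∀ {a} σ → a ∉ σ → indexOf a σ ≡ length σ
indexOf-∉ σ a∉ = trans (cong (indexOf _) (sym (++-identityʳ σ)))
                       (trans (indexOf-++-∉ σ [] a∉) (+-identityʳ _))

indexOf<length : ∀ {a} σ → a ∈ σ → indexOf a σ < length σ
indexOf<length {a} (b ∷ σ) a∈ with a ≟ b | a∈
... | yes _  | _          = s≤s z≤n
... | no  _  | there a∈σ = s≤s (indexOf<length σ a∈σ)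
... | no a≢b | here a≡b  = ⊥-elim (a≢b a≡b)

indexOf≤length : ∀ a σ → indexOf a σ ≤ length σ
indexOf≤length a []      = z≤n
indexOf≤length a (b ∷ σ) with a ≟ b
... | yes _ = z≤n
... | no  _ = s≤s (indexOf≤length a σ)

indexOf-injective : ∀ {a b} σ → a ∈ σ → b ∈ σ → indexOf a σ ≡ indexOf b σ → a ≡ b
indexOf-injective {a} {b} (c ∷ σ) a∈ b∈ eq with a ≟ c | b ≟ c
... | yes a≡c | yes b≡c = trans a≡c (sym b≡c)
indexOf-injective (c ∷ σ) a∈ b∈ eq | no a≢c | no b≢c =
  indexOf-injective σ (tail a≢c a∈) (tail b≢c b∈) (suc-injective eq)
  where
  tail : ∀ {d} → d ≢ c → d ∈ c ∷ σ → d ∈ σ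
  tail d≢c (here d≡c) = ⊥-elim (d≢c d≡c)
  tail _   (there d∈) = d∈

remember : ℕ → List ℕ → List ℕ
remember a σ with Any.any? (a ≟_) σ
... | yes _ = σ
... | no  _ = σ ++ [ a ]

remember-extends : ∀ a σ → ∃ λ δ → remember a σ ≡ σ ++ δ
remember-extends a σ with Any.any? (a ≟_) σ
... | yes _ = [] , sym (++-identityʳ σ)
... | no  _ = [ a ] , refl

∈-remember : ∀ a σ → a ∈ remember a σ
∈-remember a σ with Any.any? (a ≟_) σ
... | yes a∈σ = a∈σ
... | no  _   = ∈-++⁺ʳ σ (here refl)

indexOf-remember : ∀ a σ → indexOf a (remember a σ) ≡ indexOf a σ
indexOf-remember a σ with Any.any? (a ≟_) σ
... | yes _   = refl
... | no  a∉σ = begin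
  indexOf a (σ ++ [ a ])      ≡⟨ indexOf-++-∉ σ [ a ] a∉σ ⟩
  length σ + indexOf a [ a ] ≡⟨ cong (length σ +_) (indexOf-head a []) ⟩
  length σ + 0                ≡⟨ +-identityʳ _ ⟩
  length σ                    ≡⟨ indexOf-∉ σ a∉σ ⟨
  indexOf a σ                 ∎
  where open ≡-Reasoning

length-remember : ∀ a σ → length (remember a σ) ≡ length σ ⊔ suc (indexOf a σ)
length-remember a σ with Any.any? (a ≟_) σ
... | yes a∈σ = sym (m≥n⇒m⊔n≡m (indexOf<length σ a∈σ))
... | no  a∉σ rewrite indexOf-∉ σ a∉σ =
  trans (length-++ σ) (trans (+-comm (length σ) 1) (sym (m≤n⇒m⊔n≡n (n≤1+n (length σ)))))

relabel : ∀ {k} → List ℕ → Vec ℕ k → Vec ℕ k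
relabel σ []      = []
relabel σ (a ∷ v) = indexOf a σ ∷ relabel (remember a σ) v

labelsAfter : ∀ {k} → List ℕ → Vec ℕ k → List ℕ
labelsAfter σ []      = σ
labelsAfter σ (a ∷ v) = labelsAfter (remember a σ) v

labelsAfter-extends : ∀ {k} σ (v : Vec ℕ k) → ∃ λ δ → labelsAfter σ v ≡ σ ++ δ
labelsAfter-extends σ []      = [] , sym (++-identityʳ σ)
labelsAfter-extends σ (a ∷ v)
  with δ , eq ← remember-extends a σ | δ′ , eq′ ← labelsAfter-extends (remember a σ) v
  = δ ++ δ′ , trans eq′ (trans (cong (_++ δ′) eq) (++-assoc σ δ δ′))

∈-labelsAfter : ∀ {k} σ (v : Vec ℕ k) i → lookup v i ∈ labelsAfter σ v
∈-labelsAfter σ (a ∷ v) zero with δ , eq ← labelsAfter-extends (remember a σ) v rewrite eq =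
  ∈-++⁺ˡ (∈-remember a σ)
∈-labelsAfter σ (a ∷ v) (suc i) = ∈-labelsAfter (remember a σ) v i

lookup-relabel : ∀ {k} σ (v : Vec ℕ k) i →
                 lookup (relabel σ v) i ≡ indexOf (lookup v i) (labelsAfter σ v)
lookup-relabel σ (a ∷ v) zero with δ , eq ← labelsAfter-extends (remember a σ) v rewrite eq =
  sym (trans (indexOf-++-∈ (remember a σ) δ (∈-remember a σ)) (indexOf-remember a σ))
lookup-relabel σ (a ∷ v) (suc i) = lookup-relabel (remember a σ) v i

RGS-relabel : ∀ {k} σ (v : Vec ℕ k) → RGS (length σ) (relabel σ v)
RGS-relabel σ []      = []
RGS-relabel σ (a ∷ v) =
  indexOf≤length a σ ∷ subst (λ m → RGS m (relabel (remember a σ) v)) (length-remember a σ)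
                             (RGS-relabel (remember a σ) v)

normalise : ∀ {k} → Vec ℕ k → Vec ℕ k
normalise = relabel []

normalise-sameBlock : ∀ {k} (v : Vec ℕ k) i j →
                      lookup (normalise v) i ≡ lookup (normalise v) j ⇔ lookup v i ≡ lookup v j
normalise-sameBlock v i j = mk⇔
  (λ eq → indexOf-injective σ (∈-labelsAfter [] v i) (∈-labelsAfter [] v j)
            (trans (sym (lookup-relabel [] v i)) (trans eq (lookup-relabel [] v j))))
  (λ eq → trans (lookup-relabel [] v i)
            (trans (cong (λ a → indexOf a σ) eq) (sym (lookup-relabel [] v j))))
  where σ = labelsAfter [] v

partitionOf : ∀ {n} → (Fin n → ℕ) → Partition n
partitionOf f = normalise (tabulate f)

partitionOf-∈ : ∀ {n} (f : Fin n → ℕ) → partitionOf f ∈ partitions n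
partitionOf-∈ f = from ∈-partitions⇔ (RGS-relabel [] (tabulate f))

partitionOf-sameBlock : ∀ {n} (f : Fin n → ℕ) i j →
                        lookup (partitionOf f) i ≡ lookup (partitionOf f) j ⇔ f i ≡ f j
partitionOf-sameBlock f i j =
  subst₂ (λ a b → lookup (partitionOf f) i ≡ lookup (partitionOf f) j ⇔ a ≡ b)
         (lookup∘tabulate f i) (lookup∘tabulate f j)
         (normalise-sameBlock (tabulate f) i j)

-- Pairs in a common block

Pair : ℕ → Set
Pair k = Fin k × Fin k

pair-≟ : ∀ {k} → DecidableEquality (Pair k)
pair-≟ = ×-≡-dec Fin._≟_ Fin._≟_

positions : ∀ {k} → ℕ → Vec ℕ k → List (Fin k)
positions a []      = []
positions a (b ∷ v) with a ≟ b
... | yes _ = zero ∷ map suc (positions a v)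
... | no  _ = map suc (positions a v)

occurrences : ∀ {k} → ℕ → Vec ℕ k → ℕ
occurrences a v = length (positions a v)

blockPairs : ∀ {k} → Vec ℕ k → List (Pair k)
blockPairs []      = []
blockPairs (a ∷ v) = map (λ j → zero , suc j) (positions a v) ++ map (Product.map suc suc) (blockPairs v)

pairCount : ∀ {k} → Vec ℕ k → ℕ
pairCount x = length (blockPairs x)

∈-positions⁻ : ∀ {k a} (v : Vec ℕ k) {j} → j ∈ positions a v → lookup v j ≡ a
∈-positions⁻ {a = a} (b ∷ v) j∈ with a ≟ b | j∈
... | yes a≡b | here refl = sym a≡b
... | yes _   | there j∈′ with _ , j∈v , refl ← ∈-map⁻ suc j∈′ = ∈-positions⁻ v j∈v
... | no  _   | j∈′       with _ , j∈v , refl ← ∈-map⁻ suc j∈′ = ∈-positions⁻ v j∈v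

∈-positions⁺ : ∀ {k a} (v : Vec ℕ k) j → lookup v j ≡ a → j ∈ positions a v
∈-positions⁺ {a = a} (b ∷ v) zero b≡a with a ≟ b
... | yes _   = here refl
... | no  a≢b = ⊥-elim (a≢b (sym b≡a))
∈-positions⁺ {a = a} (b ∷ v) (suc j) eq with a ≟ b
... | yes _ = there (∈-map⁺ suc (∈-positions⁺ v j eq))
... | no  _ = ∈-map⁺ suc (∈-positions⁺ v j eq)

positions-unique : ∀ {k} a (v : Vec ℕ k) → Unique (positions a v)
positions-unique a []      = []
positions-unique a (b ∷ v) with a ≟ b
... | yes _ = ¬Any⇒All¬ _ zero∉ ∷ Unique.map⁺ Fin.suc-injective (positions-unique a v)
  where
  zero∉ : zero ∉ map suc (positions a v)
  zero∉ z∈ with _ , _ , () ← ∈-map⁻ suc z∈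
... | no  _ = Unique.map⁺ Fin.suc-injective (positions-unique a v)

∈-blockPairs⇔ : ∀ {k} (x : Vec ℕ k) {i j} →
                (i , j) ∈ blockPairs x ⇔ (toℕ i < toℕ j × lookup x i ≡ lookup x j)
∈-blockPairs⇔ x = mk⇔ (sound x) (complete x _ _)
  where
  sound : ∀ {k} (x : Vec ℕ k) {i j} → (i , j) ∈ blockPairs x → toℕ i < toℕ j × lookup x i ≡ lookup x j
  sound (a ∷ v) p∈ with ∈-++⁻ (map (λ j → zero , suc j) (positions a v)) p∈
  ... | inj₁ p∈₁ with j , j∈ , refl ← ∈-map⁻ _ p∈₁ = s≤s z≤n , sym (∈-positions⁻ v j∈)
  ... | inj₂ p∈₂ with _ , p∈v , refl ← ∈-map⁻ _ p∈₂ = Product.map s≤s id (sound v p∈v)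
  complete : ∀ {k} (x : Vec ℕ k) i j → toℕ i < toℕ j × lookup x i ≡ lookup x j → (i , j) ∈ blockPairs x
  complete (a ∷ v) zero    (suc j) (_ , eq) = ∈-++⁺ˡ (∈-map⁺ _ (∈-positions⁺ v j (sym eq)))
  complete (a ∷ v) (suc i) (suc j) (s≤s i<j , eq) =
    ∈-++⁺ʳ (map (λ j → zero , suc j) (positions a v)) (∈-map⁺ _ (complete v i j (i<j , eq)))

blockPairs-unique : ∀ {k} (x : Vec ℕ k) → Unique (blockPairs x)
blockPairs-unique []      = []
blockPairs-unique (a ∷ v) =
  Unique.++⁺ (Unique.map⁺ (λ { refl → refl }) (positions-unique a v))
             (Unique.map⁺ (λ { refl → refl }) (blockPairs-unique v))
             disjoint
  where
  disjoint : ∀ {p} → ¬ (p ∈ map (λ j → zero , suc j) (positions a v) ×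
                        p ∈ map (Product.map suc suc) (blockPairs v))
  disjoint (p∈₁ , p∈₂) with _ , _ , refl ← ∈-map⁻ _ p∈₁ | _ , _ , () ← ∈-map⁻ _ p∈₂

pairCount-∷ : ∀ {k} a (v : Vec ℕ k) → pairCount (a ∷ v) ≡ occurrences a v + pairCount v
pairCount-∷ a v = trans (length-++ (map (λ j → zero , suc j) (positions a v)))
                        (cong₂ _+_ (length-map _ (positions a v)) (length-map _ (blockPairs v)))

⊑-from-< : ∀ {k} {x y : Vec ℕ k} →
           (∀ i j → toℕ i < toℕ j → lookup x i ≡ lookup x j → lookup y i ≡ lookup y j) → x ⊑ y
⊑-from-< {x = x} {y} h = refines same
  where
  same : ∀ i j → lookup x i ≡ lookup x j → lookup y i ≡ lookup y j
  same i j eq with <-cmp (toℕ i) (toℕ j)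
  ... | tri< i<j _ _ = h i j i<j eq
  ... | tri≈ _ i≡j _ rewrite Fin.toℕ-injective i≡j = refl
  ... | tri> _ _ j<i = sym (h j i j<i (sym eq))

blockPairs-⊆⇔⊑ : ∀ {k} (x y : Vec ℕ k) → blockPairs x ⊆ blockPairs y ⇔ x ⊑ y
blockPairs-⊆⇔⊑ x y = mk⇔
  (λ x⊆y → ⊑-from-< λ i j i<j eq →
     proj₂ (to (∈-blockPairs⇔ y) (x⊆y (from (∈-blockPairs⇔ x) (i<j , eq)))))
  (λ { x⊑y {i , j} p∈ → let i<j , eq = to (∈-blockPairs⇔ x) p∈ in
       from (∈-blockPairs⇔ y) (i<j , sameBlock x⊑y i j eq) })

pairCount-mono : ∀ {k} {x y : Vec ℕ k} → x ⊑ y → pairCount x ≤ pairCount y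
pairCount-mono {x = x} {y} x⊑y =
  Unique-⊆⇒length≤ pair-≟ (blockPairs-unique x) (from (blockPairs-⊆⇔⊑ x y) x⊑y)

pairCount-strict : ∀ {k} {x y : Vec ℕ k} → RGS 0 x → RGS 0 y → x ⊑ y → x ≢ y → pairCount x < pairCount y
pairCount-strict {x = x} {y} rx ry x⊑y x≢y = ≤∧≢⇒< (pairCount-mono x⊑y) λ counts≡ →
  x≢y (RGS-canonical₀ rx ry x⊑y (to (blockPairs-⊆⇔⊑ y x)
    (Unique-⊆-length≥⇒⊇ pair-≟ (blockPairs-unique x) (from (blockPairs-⊆⇔⊑ x y) x⊑y)
                         (≤-reflexive (sym counts≡)))))

pairCount≡0⇒⊑ : ∀ {k} (x y : Vec ℕ k) → pairCount x ≡ 0 → x ⊑ y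
pairCount≡0⇒⊑ x y none = to (blockPairs-⊆⇔⊑ x y) λ p∈ → ⊥-elim (<⇒≢ (∈-length p∈) (sym none))

choose₂ : ℕ → ℕ
choose₂ zero    = 0
choose₂ (suc n) = n + choose₂ n

occurrences≤length : ∀ {k} a (v : Vec ℕ k) → occurrences a v ≤ k
occurrences≤length {k} a v = subst (occurrences a v ≤_) (length-tabulate id)
  (Unique-⊆⇒length≤ Fin._≟_ (positions-unique a v) (λ _ → ∈-allFin _))

occurrences-∷-≡ : ∀ {k} a (v : Vec ℕ k) → occurrences a (a ∷ v) ≡ suc (occurrences a v)
occurrences-∷-≡ a v with a ≟ a
... | yes _   = cong suc (length-map suc (positions a v))
... | no  a≢a = ⊥-elim (a≢a refl)

occurrences-∷-≢ : ∀ {k a b} (v : Vec ℕ k) → a ≢ b → occurrences a (b ∷ v) ≡ occurrences a v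
occurrences-∷-≢ {a = a} {b} v a≢b with a ≟ b
... | yes a≡b = ⊥-elim (a≢b a≡b)
... | no  _   = length-map suc (positions a v)

occurrences-∷-≤ : ∀ {k} a b (v : Vec ℕ k) → occurrences a (b ∷ v) ≤ suc (occurrences a v)
occurrences-∷-≤ a b v with a ≟ b
... | yes _ = ≤-reflexive (cong suc (length-map suc (positions a v)))
... | no  _ = ≤-trans (≤-reflexive (length-map suc (positions a v))) (n≤1+n _)

occurrences-replicate-≢ : ∀ {a b} k → a ≢ b → occurrences a (replicate k b) ≡ 0
occurrences-replicate-≢ zero    a≢b = refl
occurrences-replicate-≢ (suc k) a≢b = trans (occurrences-∷-≢ _ a≢b) (occurrences-replicate-≢ k a≢b)

pairCount-replicate : ∀ k a → pairCount (replicate k a) ≡ choose₂ k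
pairCount-replicate zero    a = refl
pairCount-replicate (suc k) a = begin
  pairCount (a ∷ replicate k a)
    ≡⟨ pairCount-∷ a (replicate k a) ⟩
  occurrences a (replicate k a) + pairCount (replicate k a)
    ≡⟨ cong₂ _+_ (occurrences-replicate k) (pairCount-replicate k a) ⟩
  k + choose₂ k
    ∎
  where
  open ≡-Reasoning
  occurrences-replicate : ∀ k → occurrences a (replicate k a) ≡ k
  occurrences-replicate zero    = refl
  occurrences-replicate (suc k) = trans (occurrences-∷-≡ a _) (cong suc (occurrences-replicate k))

-- The occurrence bound is the induction hypothesis that makes the pair bound go through.
nonconstant-bounds : ∀ k (z : Vec ℕ (suc k)) →
                     z ≡ replicate (suc k) (head z) ⊎ (pairCount z ≤ choose₂ k × ∀ a → occurrences a z ≤ k)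
nonconstant-bounds zero    (a ∷ []) = inj₁ refl
nonconstant-bounds (suc k) (a ∷ v) with nonconstant-bounds k v
... | inj₂ (pairs≤ , occurrences≤) =
  inj₂ (pairs-bound , λ c → ≤-trans (occurrences-∷-≤ c a v) (s≤s (occurrences≤ c)))
  where
  pairs-bound : pairCount (a ∷ v) ≤ choose₂ (suc k)
  pairs-bound = subst (_≤ _) (sym (pairCount-∷ a v)) (+-mono-≤ (occurrences≤ a) pairs≤)
... | inj₁ v≡const with a ≟ head v
...   | yes refl  = inj₁ (cong (a ∷_) v≡const)
...   | no  a≢b   = inj₂ (≤-reflexive pairs≡ , occurrences-bound)
  where
  pairs≡ : pairCount (a ∷ v) ≡ choose₂ (suc k)
  pairs≡ rewrite pairCount-∷ a v | v≡const
               | occurrences-replicate-≢ (suc k) a≢b | pairCount-replicate (suc k) (head v) = refl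
  occurrences-bound : ∀ c → occurrences c (a ∷ v) ≤ suc k
  occurrences-bound c = by-cases (c ≟ a)
    where
    by-cases : Dec (c ≡ a) → occurrences c (a ∷ v) ≤ suc k
    by-cases (yes refl) = ≤-trans (occurrences-∷-≤ c c v) (s≤s (≤-trans (≤-reflexive none) z≤n))
      where
      none : occurrences c v ≡ 0
      none = trans (cong (occurrences c) v≡const) (occurrences-replicate-≢ (suc k) a≢b)
    by-cases (no c≢a)   = subst (_≤ suc k) (sym (occurrences-∷-≢ v c≢a)) (occurrences≤length c v)

RGS-top : ∀ n → RGS 0 (topΠ n)
RGS-top zero    = []
RGS-top (suc n) = z≤n ∷ zeros n
  where
  zeros : ∀ k → RGS 1 (replicate k 0)
  zeros zero    = []
  zeros (suc k) = z≤n ∷ zeros k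

⊑-top : ∀ {n} (x : Partition n) → x ⊑ topΠ n
⊑-top x = refines λ i j _ → trans (lookup-replicate i 0) (sym (lookup-replicate j 0))

RGS-bot : ∀ n → RGS 0 (botΠ n)
RGS-bot n = ascending 0 n
  where
  ascending : ∀ m k → RGS m (tabulate {k} (λ i → m + toℕ i))
  ascending m zero    = []
  ascending m (suc k) =
    ≤-reflexive (+-identityʳ m) ∷
      subst₂ (λ m v → RGS m v) m⊔ (tabulate-cong λ i → sym (+-suc m (toℕ i))) (ascending (suc m) k)
    where
    m⊔ : suc m ≡ m ⊔ suc (m + 0)
    m⊔ = sym (trans (cong (λ t → m ⊔ suc t) (+-identityʳ m)) (m≤n⇒m⊔n≡n (n≤1+n m)))

pairCount-bot : ∀ n → pairCount (botΠ n) ≡ 0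
pairCount-bot n with blockPairs (botΠ n) | (λ {i} {j} → to (∈-blockPairs⇔ (botΠ n) {i} {j}))
... | []           | _      = refl
... | (i , j) ∷ _ | paired with i<j , same ← paired (here refl) =
  ⊥-elim (<⇒≢ i<j (trans (sym (lookup∘tabulate toℕ i)) (trans same (lookup∘tabulate toℕ j))))

coatom : ∀ m → Partition (suc m)
coatom m = replicate m 0 ∷ʳ 1

coatom-∈ : ∀ m → coatom (suc m) ∈ partitions (suc (suc m))
coatom-∈ m = from ∈-partitions⇔ (z≤n ∷ tail m)
  where
  tail : ∀ m → RGS 1 (coatom m)
  tail zero    = s≤s z≤n ∷ []
  tail (suc m) = z≤n ∷ tail m

pairCount-coatom : ∀ m → pairCount (coatom m) ≡ choose₂ m
pairCount-coatom zero    = refl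
pairCount-coatom (suc m) =
  trans (pairCount-∷ 0 (coatom m)) (cong₂ _+_ (zeros m) (pairCount-coatom m))
  where
  zeros : ∀ m → occurrences 0 (coatom m) ≡ m
  zeros zero    = refl
  zeros (suc m) = trans (occurrences-∷-≡ 0 (coatom m)) (cong suc (zeros m))

pairCount-nonTop : ∀ {m} {z : Partition (suc m)} → RGS 0 z → z ≢ topΠ (suc m) → pairCount z ≤ choose₂ m
pairCount-nonTop {m} {z = a ∷ v} (a≤0 ∷ _) z≢top with nonconstant-bounds m (a ∷ v)
... | inj₂ (pairs≤ , _) = pairs≤
... | inj₁ z≡const     = ⊥-elim (z≢top (trans z≡const (cong (replicate (suc m)) (n≤0⇒n≡0 a≤0))))

-- Atoms and join-irreducibles

module _ {n : ℕ} where

  merge : Fin n → Fin n → Fin n → ℕ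
  merge p q k with k Fin.≟ q
  ... | yes _ = toℕ p
  ... | no  _ = toℕ k

  atom : Fin n → Fin n → Partition n
  atom p q = partitionOf (merge p q)

  atom-∈ : ∀ p q → atom p q ∈ partitions n
  atom-∈ p q = partitionOf-∈ (merge p q)

  atom-joins : ∀ p q → lookup (atom p q) p ≡ lookup (atom p q) q
  atom-joins p q = from (partitionOf-sameBlock (merge p q) p q) merge-joins
    where
    merge-joins : merge p q p ≡ merge p q q
    merge-joins with p Fin.≟ q | q Fin.≟ q
    ... | _ | no q≢q = ⊥-elim (q≢q refl)
    ... | yes _ | yes _ = refl
    ... | no  _ | yes _ = refl

  atom-sameBlock : ∀ {p q} u v → lookup (atom p q) u ≡ lookup (atom p q) v →
                   u ≡ v ⊎ (u ≡ p × v ≡ q) ⊎ (u ≡ q × v ≡ p)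
  atom-sameBlock {p} {q} u v same with to (partitionOf-sameBlock (merge p q) u v) same
  ... | merged with u Fin.≟ q | v Fin.≟ q
  ...   | yes refl | yes refl = inj₁ refl
  ...   | yes refl | no  _    = inj₂ (inj₂ (refl , Fin.toℕ-injective (sym merged)))
  ...   | no  _    | yes refl = inj₂ (inj₁ (Fin.toℕ-injective merged , refl))
  ...   | no  _    | no  _    = inj₁ (Fin.toℕ-injective merged)

  atom-⊑ : ∀ {p q} {z : Partition n} → lookup z p ≡ lookup z q → atom p q ⊑ z
  atom-⊑ {p} {q} z-pq = refines λ u v same → case atom-sameBlock u v same of λ where
    (inj₁ refl)                 → refl
    (inj₂ (inj₁ (refl , refl))) → z-pq
    (inj₂ (inj₂ (refl , refl))) → sym z-pq

  ∈-blockPairs-atom : ∀ {p q u v} → toℕ p < toℕ q → (u , v) ∈ blockPairs (atom p q) → (u , v) ≡ (p , q)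
  ∈-blockPairs-atom {p} {q} {u} {v} p<q uv∈ with u<v , same ← to (∈-blockPairs⇔ (atom p q)) uv∈
    with atom-sameBlock {p} {q} u v same
  ... | inj₁ refl                 = ⊥-elim (<-irrefl refl u<v)
  ... | inj₂ (inj₁ (refl , refl)) = refl
  ... | inj₂ (inj₂ (refl , refl)) = ⊥-elim (<-asym p<q u<v)

  pair∈blockPairs-atom : ∀ {p q} → toℕ p < toℕ q → (p , q) ∈ blockPairs (atom p q)
  pair∈blockPairs-atom {p} {q} p<q = from (∈-blockPairs⇔ (atom p q)) (p<q , atom-joins p q)

  pairCount-atom : ∀ {p q} → toℕ p < toℕ q → pairCount (atom p q) ≡ 1
  pairCount-atom {p} {q} p<q =
    Unique-⊆-⊇⇒length≡ pair-≟ (blockPairs-unique (atom p q)) ([] ∷ [])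
      (λ uv∈ → here (∈-blockPairs-atom p<q uv∈))
      (λ { (here refl) → pair∈blockPairs-atom p<q })

  isolate : Partition n → Fin n → Fin n → ℕ
  isolate x p k with k Fin.≟ p
  ... | yes _ = 0
  ... | no  _ = suc (lookup x k)

  splitOff : Partition n → Fin n → Partition n
  splitOff x p = partitionOf (isolate x p)

  splitOff-∈ : ∀ x p → splitOff x p ∈ partitions n
  splitOff-∈ x p = partitionOf-∈ (isolate x p)

  splitOff-⊑ : ∀ x p → splitOff x p ⊑ x
  splitOff-⊑ x p = refines λ u v same → kept u v (to (partitionOf-sameBlock _ u v) same)
    where
    kept : ∀ u v → isolate x p u ≡ isolate x p v → lookup x u ≡ lookup x v
    kept u v eq with u Fin.≟ p | v Fin.≟ p | eq
    ... | yes refl | yes refl | _   = refl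
    ... | no  _    | no  _    | eq′ = suc-injective eq′

  splitOff-keeps : ∀ x {p u v} → u ≢ p → v ≢ p → lookup x u ≡ lookup x v →
                   lookup (splitOff x p) u ≡ lookup (splitOff x p) v
  splitOff-keeps x {p} {u} {v} u≢p v≢p same =
    from (partitionOf-sameBlock _ u v) kept
    where
    kept : isolate x p u ≡ isolate x p v
    kept with u Fin.≟ p | v Fin.≟ p
    ... | yes u≡p | _       = ⊥-elim (u≢p u≡p)
    ... | no  _   | yes v≡p = ⊥-elim (v≢p v≡p)
    ... | no  _   | no  _   = cong suc same

  splitOff-separates : ∀ x {p u} → u ≢ p → lookup (splitOff x p) p ≢ lookup (splitOff x p) u
  splitOff-separates x {p} {u} u≢p same = apart (to (partitionOf-sameBlock _ p u) same)
    where
    apart : isolate x p p ≢ isolate x p u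
    apart with p Fin.≟ p | u Fin.≟ p
    ... | no  p≢p | _       = ⊥-elim (p≢p refl)
    ... | yes _   | yes u≡p = ⊥-elim (u≢p u≡p)
    ... | yes _   | no  _   = λ ()

module PartitionLattice (n : ℕ) where
  open Π n

  ∈Π⇒RGS : ∀ {x} → x ∈ partitions n → RGS 0 x
  ∈Π⇒RGS = to ∈-partitions⇔

  isJoinOf⇒ : ∀ {a b j} → T (isJoinOf a b j) →
              a ⊑ j × b ⊑ j × (∀ {c} → c ∈ partitions n → a ⊑ c → b ⊑ c → j ⊑ c)
  isJoinOf⇒ {a} {b} {j} join
    with a≤j , rest  ← to (T-∧ {a ≤Π j}) join
    with b≤j , least ← to (T-∧ {b ≤Π j}) rest
    = to (≤Π⇔⊑ a j) a≤j , to (≤Π⇔⊑ b j) b≤j , λ {c} c∈ a⊑c b⊑c →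
        to (≤Π⇔⊑ j c) (to T-not∨⇔ (allᵇ⁻ _ (partitions n) least c∈)
                          (from (T-∧ {a ≤Π c}) (from (≤Π⇔⊑ a c) a⊑c , from (≤Π⇔⊑ b c) b⊑c)))

  isJoinOf⇐ : ∀ {a b j} → a ⊑ j → b ⊑ j → (∀ {c} → a ⊑ c → b ⊑ c → j ⊑ c) → T (isJoinOf a b j)
  isJoinOf⇐ {a} {b} {j} a⊑j b⊑j least =
    from (T-∧ {a ≤Π j}) (from (≤Π⇔⊑ a j) a⊑j , from (T-∧ {b ≤Π j}) (from (≤Π⇔⊑ b j) b⊑j ,
      allᵇ⁺ _ (partitions n) λ {c} _ → from T-not∨⇔ λ both →
        let a≤c , b≤c = to (T-∧ {a ≤Π c}) both
        in from (≤Π⇔⊑ j c) (least (to (≤Π⇔⊑ a c) a≤c) (to (≤Π⇔⊑ b c) b≤c))))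

  joinIrr⇒≢bot : ∀ {j} → T (isJoinIrr j) → j ≢ botΠ n
  joinIrr⇒≢bot {j} irr refl =
    to T-not⇔¬T (proj₁ (to (T-∧ {not (j ==Π j)}) irr)) (from (==Π⇔≡ j j) refl)

  joinIrr-split : ∀ {j a b} → T (isJoinIrr j) → a ∈ partitions n → b ∈ partitions n →
                  T (isJoinOf a b j) → j ≡ a ⊎ j ≡ b
  joinIrr-split {j} {a} {b} irr a∈ b∈ join =
    Sum.map (to (==Π⇔≡ j a)) (to (==Π⇔≡ j b))
            (to (T-∨ {j ==Π a}) (to T-not∨⇔ (allᵇ⁻ _ _ (allᵇ⁻ _ _ splits a∈) b∈) join))
    where
    splits = proj₂ (to (T-∧ {not (j ==Π botΠ n)}) irr)

  joinIrr-intro : ∀ {j} → j ≢ botΠ n →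
                  (∀ {a b} → a ∈ partitions n → b ∈ partitions n → T (isJoinOf a b j) → j ≡ a ⊎ j ≡ b) →
                  T (isJoinIrr j)
  joinIrr-intro {j} j≢bot split =
    from (T-∧ {not (j ==Π botΠ n)}) (from T-not⇔¬T (j≢bot ∘ to (==Π⇔≡ j (botΠ n))) ,
      allᵇ⁺ _ _ λ {a} a∈ → allᵇ⁺ _ _ λ {b} b∈ → from T-not∨⇔ λ join →
        from T-∨ (Sum.map (from (==Π⇔≡ j a)) (from (==Π⇔≡ j b)) (split a∈ b∈ join)))

  atom-joinIrr : ∀ {j} → RGS 0 j → pairCount j ≡ 1 → T (isJoinIrr j)
  atom-joinIrr {j} rj one = joinIrr-intro j≢bot split
    where
    j≢bot : j ≢ botΠ n
    j≢bot refl = 0≢1+n (trans (sym (pairCount-bot n)) one)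
    strictly-below : ∀ {x} → x ∈ partitions n → x ⊑ j → j ≢ x → pairCount x ≡ 0
    strictly-below {x} x∈ x⊑j j≢x =
      n<1⇒n≡0 (subst (pairCount x <_) one (pairCount-strict (∈Π⇒RGS x∈) rj x⊑j (j≢x ∘ sym)))
    split : ∀ {a b} → a ∈ partitions n → b ∈ partitions n → T (isJoinOf a b j) → j ≡ a ⊎ j ≡ b
    split {a} {b} a∈ b∈ join with ≡-dec _≟_ j a | ≡-dec _≟_ j b
    ... | yes j≡a | _       = inj₁ j≡a
    ... | no  _   | yes j≡b = inj₂ j≡b
    ... | no  j≢a | no  j≢b with a⊑j , b⊑j , least ← isJoinOf⇒ join =
      case subst₂ _≤_ one (strictly-below a∈ a⊑j j≢a) (pairCount-mono j⊑a) of λ ()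
      where
      j⊑a : j ⊑ a
      j⊑a = least a∈ ⊑-refl (pairCount≡0⇒⊑ b a (strictly-below b∈ b⊑j j≢b))

  splitting : ∀ {j p q} → p ≢ q → lookup j p ≡ lookup j q → T (isJoinOf (atom p q) (splitOff j p) j)
  splitting {j} {p} {q} p≢q j-pq = isJoinOf⇐ (atom-⊑ j-pq) (splitOff-⊑ j p) least
    where
    least : ∀ {c} → atom p q ⊑ c → splitOff j p ⊑ c → j ⊑ c
    least {c} a⊑c s⊑c = refines same
      where
      elsewhere : ∀ {u v} → u ≢ p → v ≢ p → lookup j u ≡ lookup j v → lookup c u ≡ lookup c v
      elsewhere u≢p v≢p = sameBlock s⊑c _ _ ∘ splitOff-keeps j u≢p v≢p
      from-p : ∀ {v} → v ≢ p → lookup j p ≡ lookup j v → lookup c p ≡ lookup c v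
      from-p v≢p jp≡jv =
        trans (sameBlock a⊑c p q (atom-joins p q)) (elsewhere (p≢q ∘ sym) v≢p (trans (sym j-pq) jp≡jv))
      same : ∀ u v → lookup j u ≡ lookup j v → lookup c u ≡ lookup c v
      same u v eq with u Fin.≟ p | v Fin.≟ p
      ... | yes refl | yes refl = refl
      ... | yes refl | no  v≢p  = from-p v≢p eq
      ... | no  u≢p  | yes refl = sym (from-p u≢p (sym eq))
      ... | no  u≢p  | no  v≢p  = elsewhere u≢p v≢p eq

  nonAtom-not-joinIrr : ∀ {j} → 2 ≤ pairCount j → ¬ T (isJoinIrr j)
  nonAtom-not-joinIrr {j} two irr
    with (p , q) , pq∈ ← ∃-∈ {xs = blockPairs j} (≤-trans (s≤s z≤n) two)
    with p<q , j-pq ← to (∈-blockPairs⇔ j) pq∈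
    with joinIrr-split {j} irr (atom-∈ p q) (splitOff-∈ j p) (splitting (<⇒≢ p<q ∘ cong toℕ) j-pq)
  ... | inj₁ j≡atom     = case subst (2 ≤_) (trans (cong pairCount j≡atom) (pairCount-atom p<q)) two of λ where
                            (s≤s ())
  ... | inj₂ j≡splitOff = splitOff-separates j (<⇒≢ p<q ∘ cong toℕ ∘ sym)
                            (subst (λ x → lookup x p ≡ lookup x q) j≡splitOff j-pq)

  joinIrr⇔atom : ∀ {j} → j ∈ partitions n → T (isJoinIrr j) ⇔ pairCount j ≡ 1
  joinIrr⇔atom {j} j∈ = mk⇔ isAtom (atom-joinIrr (∈Π⇒RGS j∈))
    where
    isAtom : T (isJoinIrr j) → pairCount j ≡ 1
    isAtom irr with pairCount j in count
    ... | 0           = ⊥-elim (joinIrr⇒≢bot {j} irr (RGS-canonical₀ (∈Π⇒RGS j∈) (RGS-bot n)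
                          (pairCount≡0⇒⊑ j (botΠ n) count) (pairCount≡0⇒⊑ (botΠ n) j (pairCount-bot n))))
    ... | 1           = refl
    ... | suc (suc _) = ⊥-elim (nonAtom-not-joinIrr {j} (subst (2 ≤_) (sym count) (s≤s (s≤s z≤n))) irr)

  single-pair⇒atom : ∀ {j p q} → RGS 0 j → blockPairs j ≡ [ (p , q) ] → j ≡ atom p q
  single-pair⇒atom {j} {p} {q} rj pairs =
    RGS-canonical₀ rj (∈Π⇒RGS (atom-∈ p q)) j⊑atom (atom-⊑ (proj₂ ordered-same))
    where
    ordered-same : toℕ p < toℕ q × lookup j p ≡ lookup j q
    ordered-same = to (∈-blockPairs⇔ j) (subst ((p , q) ∈_) (sym pairs) (here refl))
    j⊑atom : j ⊑ atom p q
    j⊑atom = to (blockPairs-⊆⇔⊑ j (atom p q)) λ uv∈ → case subst (_ ∈_) pairs uv∈ of λ where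
      (here refl) → pair∈blockPairs-atom (proj₁ ordered-same)

  nJ≤≡pairCount : ∀ {y} → y ∈ partitions n → nJ≤ y ≡ pairCount y
  nJ≤≡pairCount {y} y∈ =
    trans (Unique-⊆-⊇⇒length≡ (≡-dec _≟_) (Unique.filter⁺ (T? ∘ joinIrrBelow) (partitions-unique n))
                                atoms-unique below⊆atoms atoms⊆below)
          (length-map atomOf (blockPairs y))
    where
    joinIrrBelow : Partition n → Bool
    joinIrrBelow j = isJoinIrr j ∧ (j ≤Π y)
    atomOf : Pair n → Partition n
    atomOf (p , q) = atom p q
    atoms-unique : Unique (map atomOf (blockPairs y))
    atoms-unique = map-unique atomOf (blockPairs-unique y) λ {(p , q)} {(r , s)} pq∈ rs∈ same →
      ∈-blockPairs-atom (proj₁ (to (∈-blockPairs⇔ y) rs∈))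
        (subst (λ x → (p , q) ∈ blockPairs x) same (pair∈blockPairs-atom (proj₁ (to (∈-blockPairs⇔ y) pq∈))))
    below⊆atoms : filterᵇ joinIrrBelow (partitions n) ⊆ map atomOf (blockPairs y)
    below⊆atoms {j} j∈
      with j∈Π , irr-below ← ∈-filter⁻ (T? ∘ joinIrrBelow) j∈
      with irr , j≤y ← to (T-∧ {isJoinIrr j}) irr-below
      with blockPairs j in pairs | to (joinIrr⇔atom j∈Π) irr
    ... | (p , q) ∷ [] | _ =
      subst (_∈ map atomOf (blockPairs y)) (sym (single-pair⇒atom (∈Π⇒RGS j∈Π) pairs))
        (∈-map⁺ atomOf (from (blockPairs-⊆⇔⊑ j y) (to (≤Π⇔⊑ j y) j≤y)
                         (subst ((p , q) ∈_) (sym pairs) (here refl))))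
    atoms⊆below : map atomOf (blockPairs y) ⊆ filterᵇ joinIrrBelow (partitions n)
    atoms⊆below a∈
      with (p , q) , pq∈ , refl ← ∈-map⁻ atomOf a∈
      with p<q , y-pq ← to (∈-blockPairs⇔ y) pq∈ =
      ∈-filter⁺ (T? ∘ joinIrrBelow) (atom-∈ p q)
        (from (T-∧ {isJoinIrr (atom p q)}) (from (joinIrr⇔atom (atom-∈ p q)) (pairCount-atom p<q) ,
                                           from (≤Π⇔⊑ (atom p q) y) (atom-⊑ y-pq)))

  nJ≡choose₂ : nJ ≡ choose₂ n
  nJ≡choose₂ = begin
    nJ                  ≡⟨ cong length (filter-≐ (T? ∘ isJoinIrr) (T? ∘ belowTop) same-filter (partitions n)) ⟩
    nJ≤ (topΠ n)        ≡⟨ nJ≤≡pairCount (from ∈-partitions⇔ (RGS-top n)) ⟩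
    pairCount (topΠ n) ≡⟨ pairCount-replicate n 0 ⟩
    choose₂ n           ∎
    where
    open ≡-Reasoning
    belowTop : Partition n → Bool
    belowTop j = isJoinIrr j ∧ (j ≤Π topΠ n)
    irr⇒below : ∀ {j} → T (isJoinIrr j) → T (belowTop j)
    irr⇒below {j} irr = from (T-∧ {isJoinIrr j}) (irr , from (≤Π⇔⊑ j (topΠ n)) (⊑-top j))
    below⇒irr : ∀ {j} → T (belowTop j) → T (isJoinIrr j)
    below⇒irr {j} = proj₁ ∘ to (T-∧ {isJoinIrr j})
    same-filter : (T ∘ isJoinIrr) ≐ (T ∘ belowTop)
    same-filter = (λ {j} → irr⇒below {j}) , (λ {j} → below⇒irr {j})

<-choose₂ : ∀ k → 4 + k < choose₂ (4 + k)
<-choose₂ zero    = s≤s (s≤s (s≤s (s≤s (s≤s z≤n))))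
<-choose₂ (suc k) = +-mono-≤ (s≤s (z≤n {3 + k})) (<-choose₂ k)

mobius-maximalNonTop : ∀ m {y} → y ∈ partitions (2 + m) → pairCount y ≡ choose₂ (suc m) →
                       Π.mobius (2 + m) y (topΠ (2 + m)) ℤ.≤ -1ℤ
mobius-maximalNonTop m {y} y∈ y-pairs =
  mobiusF-coatom (length≥2 y∈ top∈ y≢top) (from (==Π⇔≡ top top) refl) (y≢top ∘ to (==Π⇔≡ y top))
                (from (≤Π⇔⊑ y top) (⊑-top y)) top-above only-top
  where
  open PartitionLattice (2 + m)
  open FiniteLatticeProperties (_==Π_ {2 + m}) _≤Π_ (partitions (2 + m)) (botΠ (2 + m)) (topΠ (2 + m))
  top = topΠ (2 + m)
  top∈ : top ∈ partitions (2 + m)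
  top∈ = from ∈-partitions⇔ (RGS-top (2 + m))
  y≢top : y ≢ top
  y≢top refl = m≢1+n+m (choose₂ (suc m)) {m} (sym (trans (sym (pairCount-replicate (2 + m) 0)) y-pairs))
  coverage : Partition (2 + m) → Bool
  coverage z = (y ≤Π z) ∧ not (y ==Π z) ∧ (z ≤Π top)
  top-above : top ∈ strictlyAbove y
  top-above = ∈-filter⁺ (T? ∘ coverage) top∈
    (from (T-∧ {y ≤Π top}) (from (≤Π⇔⊑ y top) (⊑-top y) ,
     from (T-∧ {not (y ==Π top)}) (from T-not⇔¬T (y≢top ∘ to (==Π⇔≡ y top)) ,
                                   from (≤Π⇔⊑ top top) ⊑-refl)))
  only-top : ∀ {z} → z ∈ strictlyAbove y → z ≡ top
  only-top {z} z∈ with ≡-dec _≟_ z top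
  ... | yes z≡top = z≡top
  ... | no  z≢top with z∈Π , covers ← ∈-filter⁻ (T? ∘ coverage) z∈
    with y≤z , rest ← to (T-∧ {y ≤Π z}) covers =
    contradiction (subst (pairCount z ≤_) (sym y-pairs) (pairCount-nonTop (∈Π⇒RGS z∈Π) z≢top))
      (<⇒≱ (pairCount-strict (∈Π⇒RGS y∈) (∈Π⇒RGS z∈Π) (to (≤Π⇔⊑ y z) y≤z)
              (to T-not⇔¬T (proj₁ (to (T-∧ {not (y ==Π z)}) rest)) ∘ from (==Π⇔≡ y z))))

Π≥5-notWeaklyCosetLike : ∀ k → ¬ PartitionLatticeWeaklyCosetLike (5 + k)
Π≥5-notWeaklyCosetLike k wcl = >⇒∤ (<-choose₂ k) (∣m+n∣m⇒∣n pairs∣ ∣-refl)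
  where
  m = 4 + k
  open Π (suc m)
  open PartitionLattice (suc m)
  open FiniteLatticeProperties (_==Π_ {suc m}) _≤Π_ (partitions (suc m)) (botΠ (suc m)) (topΠ (suc m))
  c = coatom m
  c∈ : c ∈ partitions (suc m)
  c∈ = coatom-∈ (3 + k)
  c-pairs : nJ≤ c ≡ choose₂ m
  c-pairs = trans (nJ≤≡pairCount c∈) (pairCount-coatom m)
  c≢bot : c ≢ botΠ (suc m)
  c≢bot c≡bot = 0≢1+n (trans (sym (pairCount-bot (suc m))) (trans (cong pairCount (sym c≡bot)) (pairCount-coatom m)))
  sameBase⇒pairCount : ∀ {y} → y ∈ partitions (suc m) → nJ * nJ≤ y ≡ nJ * nJ≤ c →
                       pairCount y ≡ choose₂ m
  sameBase⇒pairCount {y} y∈ same = begin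
    pairCount y ≡⟨ nJ≤≡pairCount y∈ ⟨
    nJ≤ y       ≡⟨ *-cancelˡ-≡ _ _ (choose₂ (suc m))
                     (subst (λ t → t * nJ≤ y ≡ t * nJ≤ c) nJ≡choose₂ same) ⟩
    nJ≤ c       ≡⟨ c-pairs ⟩
    choose₂ m   ∎
    where open ≡-Reasoning
  coeff≢0 : collectedCoeff c ≢ 0ℤ
  coeff≢0 = collectedCoeff≢0 c∈ (c≢bot ∘ to (==Π⇔≡ c (botΠ (suc m))))
              λ y∈ same → mobius-maximalNonTop (3 + k) y∈ (sameBase⇒pairCount y∈ same)
  pairs∣ : choose₂ m ∣ choose₂ m + m
  pairs∣ = subst₂ _∣_ c-pairs (trans nJ≡choose₂ (+-comm m (choose₂ m))) (wcl c c∈ c≢bot coeff≢0)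

weaklyCosetLike-by-evaluation : ∀ n →
  {True (all? (λ x → ≡-dec _≟_ x (botΠ n) ⊎-dec (Π.nJ≤ n x ∣? Π.nJ n)) (partitions n))} →
  PartitionLatticeWeaklyCosetLike n
weaklyCosetLike-by-evaluation n {checked} =
  FiniteLatticeProperties.weaklyCosetLike-by-divisibility _==Π_ _≤Π_ (partitions n) (botΠ n) (topΠ n)
    (toWitness checked)

Π₂-weaklyCosetLike : PartitionLatticeWeaklyCosetLike 2
Π₂-weaklyCosetLike = weaklyCosetLike-by-evaluation 2

Π₃-weaklyCosetLike : PartitionLatticeWeaklyCosetLike 3
Π₃-weaklyCosetLike = weaklyCosetLike-by-evaluation 3

Π₄-weaklyCosetLike : PartitionLatticeWeaklyCosetLike 4
Π₄-weaklyCosetLike = weaklyCosetLike-by-evaluation 4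

two-to-four : ∀ {n} → 2 ≤ n → n ≤ 4 → n ≡ 2 ⊎ n ≡ 3 ⊎ n ≡ 4
two-to-four {2} _ _ = inj₁ refl
two-to-four {3} _ _ = inj₂ (inj₁ refl)
two-to-four {4} _ _ = inj₂ (inj₂ refl)
two-to-four {suc (suc (suc (suc (suc _))))} _ (s≤s (s≤s (s≤s (s≤s ()))))
two-to-four {1} (s≤s ()) _

Π≤4-weaklyCosetLike : ∀ {n} → 2 ≤ n → n ≤ 4 → PartitionLatticeWeaklyCosetLike n
Π≤4-weaklyCosetLike 2≤n n≤4 with two-to-four 2≤n n≤4
... | inj₁ n≡2        = subst PartitionLatticeWeaklyCosetLike (sym n≡2) Π₂-weaklyCosetLike
... | inj₂ (inj₁ n≡3) = subst PartitionLatticeWeaklyCosetLike (sym n≡3) Π₃-weaklyCosetLike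
... | inj₂ (inj₂ n≡4) = subst PartitionLatticeWeaklyCosetLike (sym n≡4) Π₄-weaklyCosetLike

weaklyCosetLike⇒≤4 : ∀ n → PartitionLatticeWeaklyCosetLike n → n ≤ 4
weaklyCosetLike⇒≤4 n wcl with n ≤? 4
... | yes n≤4 = n≤4
... | no  n≰4 with k , 5+k≡n ← m≤n⇒∃[o]m+o≡n (≰⇒> n≰4) =
  ⊥-elim (Π≥5-notWeaklyCosetLike k (subst PartitionLatticeWeaklyCosetLike (sym 5+k≡n) wcl))

mainTheorem5 : (n : ℕ) → 2 ≤ n → (PartitionLatticeWeaklyCosetLike n ⇔ n ≤ 4)
mainTheorem5 n 2≤n = mk⇔ (weaklyCosetLike⇒≤4 n) (Π≤4-weaklyCosetLike 2≤n)
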